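{- Let $m$ be a positive integer and $G$ a connected, almost asymmetric graph. If $n(G)-\max_{v^*\in V(G^*)}|v^*|\neq m$, then $D(G)\neq n(G)-m$.
   Context: All graphs are finite and simple; $n(G)$ is the number of vertices. Two vertices $u,v$ of $G$ are twins if $N_G(v)\setminus\{u\}=N_G(u)\setminus\{v\}$. Setting $u\equiv v$ if $u=v$ or $u,v$ are twins gives an equivalence relation; the class of $v$ is $v^*$. The twin graph $G^*$ has vertex set $\{v^*: v\in V(G)\}$ and edges $u^*v^*$ for $uv\in E(G)$. $G$ is almost asymmetric if no automorphism of $G$ maps a vertex of one twin equivalence class to a vertex of another twin equivalence class. The distinguishing number $D(G)$ is the minimum number of colors in a vertex coloring preserved by no non-trivial automorphism of $G$. -}

module Defs where

open import Data.Nat using (ℕ; _≤_; _+_)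
open import Data.Bool using (Bool; true; false; _≟_)
open import Data.Fin using (Fin)
open import Data.Fin.Properties using (all?) renaming (_≟_ to _≟ᶠ_)
open import Data.Fin.Permutation using (Permutation′; _⟨$⟩ʳ_)
open import Data.Fin.Subset using (Subset; ∣_∣)
open import Data.Vec using (tabulate)
open import Data.Product using (Σ; ∃; _×_; _,_)
open import Data.Sum using (_⊎_)
open import Relation.Nullary using (¬_; Dec; yes; no; does)
open import Relation.Nullary.Decidable using (_⊎-dec_)
open import Relation.Binary.PropositionalEquality using (_≡_; _≢_)
open import Relation.Binary.Construct.Closure.ReflexiveTransitive using (Star)

record Graph (n : ℕ) : Set where
  field
    adj   : Fin n → Fin n → Bool
    sym   : ∀ u v → adj u v ≡ adj v u
    irrefl : ∀ v → adj v v ≡ false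

open Graph public

module _ {n : ℕ} (G : Graph n) where

  Edge : Fin n → Fin n → Set
  Edge u v = adj G u v ≡ true

  Connected : Set
  Connected = ∀ u v → Star Edge u v

  Twins : Fin n → Fin n → Set
  Twins u v = ∀ w → w ≢ u → w ≢ v → adj G u w ≡ adj G v w

  TwinEquiv : Fin n → Fin n → Set
  TwinEquiv u v = (u ≡ v) ⊎ Twins u v

  twins? : ∀ u v → Dec (Twins u v)
  twins? u v = all? (λ w → (w ≟ᶠ u) →-dec' ((w ≟ᶠ v) →-dec' (adj G u w ≟ adj G v w)))
    where
    _→-dec'_ : ∀ {A B : Set} → Dec A → Dec B → Dec (¬ A → B)
    _→-dec'_ (yes a) _ = yes (λ na → Data.Empty.⊥-elim (na a)) where import Data.Empty
    _→-dec'_ (no na) (yes b) = yes (λ _ → b)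
    _→-dec'_ (no na) (no nb) = no (λ f → nb (f na))

  twinEquiv? : ∀ u v → Dec (TwinEquiv u v)
  twinEquiv? u v = (u ≟ᶠ v) ⊎-dec twins? u v

  twinClass : Fin n → Subset n
  twinClass v = tabulate (λ w → does (twinEquiv? v w))

  twinClassSize : Fin n → ℕ
  twinClassSize v = ∣ twinClass v ∣

  IsMaxTwinClassSize : ℕ → Set
  IsMaxTwinClassSize s = (∃ λ v → twinClassSize v ≡ s) × (∀ v → twinClassSize v ≤ s)

  IsAutomorphism : Permutation′ n → Set
  IsAutomorphism σ = ∀ u v → adj G (σ ⟨$⟩ʳ u) (σ ⟨$⟩ʳ v) ≡ adj G u v

  AlmostAsymmetric : Set
  AlmostAsymmetric = ∀ σ → IsAutomorphism σ → ∀ v → TwinEquiv v (σ ⟨$⟩ʳ v)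

  Distinguishing : {k : ℕ} → (Fin n → Fin k) → Set
  Distinguishing c = ∀ σ → IsAutomorphism σ → (∀ v → c (σ ⟨$⟩ʳ v) ≡ c v) →
                     ∀ v → σ ⟨$⟩ʳ v ≡ v

  HasDistinguishingColouring : ℕ → Set
  HasDistinguishingColouring k = Σ (Fin n → Fin k) Distinguishing

  IsDistinguishingNumber : ℕ → Set
  IsDistinguishingNumber d = HasDistinguishingColouring d ×
                             (∀ k → HasDistinguishingColouring k → d ≤ k)

{-# OPTIONS --safe #-}
-- For an almost asymmetric graph, D(G) is exactly the largest twin-class
-- size s. Swapping two twins is an automorphism, so a distinguishing colouring
-- must be injective on every twin class, whence D(G) ≥ s. Conversely every
-- automorphism maps each twin class into itself, so colouring each vertex by
-- its rank inside its own twin class uses at most s colours and is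
-- distinguishing. Thus D(G) + m = s + m ≠ n.
module Submission where

open import Defs
open import Data.Nat using (ℕ; _+_; NonZero)
open import Relation.Binary.PropositionalEquality using (_≢_)

open import Data.Nat.Properties as ℕ using (≤-antisym; <-≤-trans)
open import Data.Nat using (_≤_; _<_)
open import Data.Fin as Fin using (Fin; zero; suc; toℕ; fromℕ<; _≟_)
open import Data.Fin.Properties
  using (<-cmp; <-trans; <-irrefl; toℕ-fromℕ<; suc-injective; injective⇒≤)
open import Data.Fin.Permutation using (transpose; _⟨$⟩ʳ_)
open import Data.Fin.Subset using (Subset; inside; outside; ∣_∣; _∈_; _∉_; _⊂_; _∩_)
open import Data.Fin.Subset.Properties using (p⊂q⇒∣p∣<∣q∣; p∩q⊆q; x∈p∩q⁺; x∈p∩q⁻)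
open import Data.Vec using (_∷_; tabulate)
open import Data.Vec.Properties
  using (lookup∘tabulate; []=⇒lookup; lookup⇒[]=; tabulate-cong)
open import Data.Vec.Base using (here; there)
open import Data.Product using (_,_; proj₁)
open import Data.Sum using (inj₁; inj₂)
open import Level using (Level)
open import Function using (_∘_; mk⇔)
open import Function.Definitions using (Injective)
open import Relation.Nullary using (yes; no; does; contradiction)
open import Relation.Nullary.Decidable using (dec-true; does-⇔)
open import Relation.Unary using (Pred; Decidable)
open import Relation.Binary using (tri<; tri≈; tri>)
open import Relation.Binary.PropositionalEquality
  using (_≡_; refl; trans; cong; subst; ≢-sym; module ≡-Reasoning)
import Relation.Binary.PropositionalEquality as ≡

enumerate : ∀ {n} (p : Subset n) → Fin ∣ p ∣ → Fin n
enumerate (inside ∷ p)  zero    = zero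
enumerate (inside ∷ p)  (suc i) = suc (enumerate p i)
enumerate (outside ∷ p) i       = suc (enumerate p i)

enumerate-∈ : ∀ {n} (p : Subset n) (i : Fin ∣ p ∣) → enumerate p i ∈ p
enumerate-∈ (inside ∷ p)  zero    = here
enumerate-∈ (inside ∷ p)  (suc i) = there (enumerate-∈ p i)
enumerate-∈ (outside ∷ p) i       = there (enumerate-∈ p i)

enumerate-injective : ∀ {n} (p : Subset n) → Injective _≡_ _≡_ (enumerate p)
enumerate-injective (inside ∷ p)  {zero}  {zero}  _  = refl
enumerate-injective (inside ∷ p)  {suc i} {suc j} eq =
  cong suc (enumerate-injective p (suc-injective eq))
enumerate-injective (outside ∷ p)                 eq = enumerate-injective p (suc-injective eq)

module _ {n : ℕ} where

  ∈-tabulate-does⁺ : {ℓ : Level} {P : Pred (Fin n) ℓ} (P? : Decidable P) {x : Fin n} →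
                     P x → x ∈ tabulate (does ∘ P?)
  ∈-tabulate-does⁺ P? {x} px =
    lookup⇒[]= x _ (trans (lookup∘tabulate (does ∘ P?) x) (dec-true (P? x) px))

  ∈-tabulate-does⁻ : {ℓ : Level} {P : Pred (Fin n) ℓ} (P? : Decidable P) {x : Fin n} →
                     x ∈ tabulate (does ∘ P?) → P x
  ∈-tabulate-does⁻ P? {x} x∈
    with P? x | trans (≡.sym (lookup∘tabulate (does ∘ P?) x)) ([]=⇒lookup x∈)
  ... | yes px | _  = px
  ... | no _   | ()

  InjectiveOn : {a : Level} {A : Set a} → Subset n → (Fin n → A) → Set a
  InjectiveOn p f = ∀ {x y} → x ∈ p → y ∈ p → f x ≡ f y → x ≡ y

  injectiveOn⇒∣p∣≤ : {k : ℕ} {p : Subset n} (f : Fin n → Fin k) →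
                     InjectiveOn p f → ∣ p ∣ ≤ k
  injectiveOn⇒∣p∣≤ {p = p} f f-inj =
    injective⇒≤ (enumerate-injective p ∘ f-inj (enumerate-∈ p _) (enumerate-∈ p _))

  below : Fin n → Subset n
  below v = tabulate (does ∘ (Fin._<? v))

  ∈-below⁺ : ∀ {u v} → u Fin.< v → u ∈ below v
  ∈-below⁺ {v = v} = ∈-tabulate-does⁺ (Fin._<? v)

  ∈-below⁻ : ∀ {u v} → u ∈ below v → u Fin.< v
  ∈-below⁻ {v = v} = ∈-tabulate-does⁻ (Fin._<? v)

  ∉below∩ : (p : Subset n) (v : Fin n) → v ∉ below v ∩ p
  ∉below∩ p v v∈ = <-irrefl refl (∈-below⁻ (proj₁ (x∈p∩q⁻ (below v) p v∈)))

  below∩-⊂ : {p : Subset n} {u v : Fin n} → u Fin.< v → u ∈ p →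
             below u ∩ p ⊂ below v ∩ p
  below∩-⊂ {p} {u} {v} u<v u∈p =
    below∩-⊆ , u , x∈p∩q⁺ (∈-below⁺ u<v , u∈p) , ∉below∩ p u
    where
    below∩-⊆ : ∀ {x} → x ∈ below u ∩ p → x ∈ below v ∩ p
    below∩-⊆ x∈ with x∈p∩q⁻ (below u) p x∈
    ... | x<u , x∈p = x∈p∩q⁺ (∈-below⁺ (<-trans (∈-below⁻ x<u) u<v) , x∈p)

  ∣below∩p∣<∣p∣ : {p : Subset n} {v : Fin n} → v ∈ p → ∣ below v ∩ p ∣ < ∣ p ∣
  ∣below∩p∣<∣p∣ {p} {v} v∈p =
    p⊂q⇒∣p∣<∣q∣ (p∩q⊆q (below v) p , v , v∈p , ∉below∩ p v)

  ∣below∩p∣-injectiveOn : (p : Subset n) → InjectiveOn p (λ v → ∣ below v ∩ p ∣)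
  ∣below∩p∣-injectiveOn p {u} {v} u∈p v∈p eq with <-cmp u v
  ... | tri< u<v _ _ = contradiction eq (ℕ.<⇒≢ (p⊂q⇒∣p∣<∣q∣ (below∩-⊂ u<v u∈p)))
  ... | tri≈ _ u≡v _ = u≡v
  ... | tri> _ _ v<u = contradiction (≡.sym eq) (ℕ.<⇒≢ (p⊂q⇒∣p∣<∣q∣ (below∩-⊂ v<u v∈p)))

data TransposeView {n : ℕ} (i j : Fin n) : Fin n → Fin n → Set where
  sends-i : TransposeView i j i j
  sends-j : TransposeView i j j i
  fixes   : ∀ {k} → k ≢ i → k ≢ j → TransposeView i j k k

transpose-view : ∀ {n} (i j k : Fin n) → TransposeView i j k (transpose i j ⟨$⟩ʳ k)
transpose-view i j k with k ≟ i
... | yes refl = sends-i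
... | no k≢i with k ≟ j
...   | yes refl = sends-j
...   | no k≢j   = fixes k≢i k≢j

transpose-sendsˡ : ∀ {n} (i j : Fin n) → transpose i j ⟨$⟩ʳ i ≡ j
transpose-sendsˡ i j with transpose i j ⟨$⟩ʳ i | transpose-view i j i
... | _ | sends-i     = refl
... | _ | sends-j     = refl
... | _ | fixes i≢i _ = contradiction refl i≢i

module _ {n : ℕ} (G : Graph n) where

  twinEquiv-sym : ∀ {u v} → TwinEquiv G u v → TwinEquiv G v u
  twinEquiv-sym (inj₁ u≡v) = inj₁ (≡.sym u≡v)
  twinEquiv-sym (inj₂ uv)  = inj₂ (λ x x≢v x≢u → ≡.sym (uv x x≢u x≢v))

  twinEquiv-trans : ∀ {u v w} → TwinEquiv G u v → TwinEquiv G v w → TwinEquiv G u w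
  twinEquiv-trans (inj₁ refl) vw          = vw
  twinEquiv-trans uv          (inj₁ refl) = uv
  twinEquiv-trans {u} {v} {w} (inj₂ uv) (inj₂ vw) with u ≟ w
  ... | yes u≡w = inj₁ u≡w
  ... | no u≢w  = inj₂ uw
    where
    uw : Twins G u w
    uw x x≢u x≢w with x ≟ v
    ... | no x≢v   = trans (uv x x≢u x≢v) (vw x x≢v x≢w)
    ... | yes refl = begin
      adj G u x  ≡⟨ Graph.sym G u x ⟩
      adj G x u  ≡⟨ vw u (≢-sym x≢u) u≢w ⟩
      adj G w u  ≡⟨ Graph.sym G w u ⟩
      adj G u w  ≡⟨ uv w (≢-sym u≢w) (≢-sym x≢w) ⟩
      adj G x w  ≡⟨ Graph.sym G x w ⟩
      adj G w x  ∎
      where open ≡-Reasoning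

  ∈-twinClass⁺ : ∀ {v w} → TwinEquiv G v w → w ∈ twinClass G v
  ∈-twinClass⁺ {v} = ∈-tabulate-does⁺ (twinEquiv? G v)

  ∈-twinClass⁻ : ∀ {v w} → w ∈ twinClass G v → TwinEquiv G v w
  ∈-twinClass⁻ {v} = ∈-tabulate-does⁻ (twinEquiv? G v)

  twinClass-cong : ∀ {u v} → TwinEquiv G u v → twinClass G u ≡ twinClass G v
  twinClass-cong {u} {v} uv = tabulate-cong λ w →
    does-⇔ (mk⇔ (twinEquiv-trans (twinEquiv-sym uv)) (twinEquiv-trans uv))
           (twinEquiv? G u w) (twinEquiv? G v w)

  adj-diag : ∀ a b → adj G a a ≡ adj G b b
  adj-diag a b = trans (irrefl G a) (≡.sym (irrefl G b))

  twins-adjʳ : ∀ {u w x} → Twins G u w → x ≢ u → x ≢ w → adj G x u ≡ adj G x w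
  twins-adjʳ {u} {w} {x} uw x≢u x≢w =
    trans (Graph.sym G x u) (trans (uw x x≢u x≢w) (Graph.sym G w x))

  transpose-twins-isAutomorphism : ∀ {u w} → Twins G u w → IsAutomorphism G (transpose u w)
  transpose-twins-isAutomorphism {u} {w} uw x y
    with transpose u w ⟨$⟩ʳ x | transpose-view u w x | transpose u w ⟨$⟩ʳ y | transpose-view u w y
  ... | _ | sends-i       | _ | sends-i       = adj-diag w u
  ... | _ | sends-i       | _ | sends-j       = Graph.sym G w u
  ... | _ | sends-i       | _ | fixes y≢u y≢w = ≡.sym (uw y y≢u y≢w)
  ... | _ | sends-j       | _ | sends-i       = Graph.sym G u w
  ... | _ | sends-j       | _ | sends-j       = adj-diag u w
  ... | _ | sends-j       | _ | fixes y≢u y≢w = uw y y≢u y≢w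
  ... | _ | fixes x≢u x≢w | _ | sends-i       = ≡.sym (twins-adjʳ uw x≢u x≢w)
  ... | _ | fixes x≢u x≢w | _ | sends-j       = twins-adjʳ uw x≢u x≢w
  ... | _ | fixes x≢u x≢w | _ | fixes _ _     = refl

  InjectiveOnTwinClasses : {a : Level} {A : Set a} → (Fin n → A) → Set a
  InjectiveOnTwinClasses c = ∀ {u v} → TwinEquiv G u v → c u ≡ c v → u ≡ v

  distinguishing⇒injectiveOnTwinClasses : {k : ℕ} {c : Fin n → Fin k} →
                                           Distinguishing G c → InjectiveOnTwinClasses c
  distinguishing⇒injectiveOnTwinClasses c-dist (inj₁ u≡v) _ = u≡v
  distinguishing⇒injectiveOnTwinClasses {c = c} c-dist {u} {v} (inj₂ uv) cu≡cv =
    trans (≡.sym (c-dist τ (transpose-twins-isAutomorphism uv) τ-preserves-c u))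
          (transpose-sendsˡ u v)
    where
    τ = transpose u v
    τ-preserves-c : ∀ x → c (τ ⟨$⟩ʳ x) ≡ c x
    τ-preserves-c x with τ ⟨$⟩ʳ x | transpose-view u v x
    ... | _ | sends-i   = ≡.sym cu≡cv
    ... | _ | sends-j   = cu≡cv
    ... | _ | fixes _ _ = refl

  injectiveOnTwinClasses⇒twinClassSize≤ : {k : ℕ} {c : Fin n → Fin k} →
                                           InjectiveOnTwinClasses c → ∀ v → twinClassSize G v ≤ k
  injectiveOnTwinClasses⇒twinClassSize≤ {c = c} c-inj v =
    injectiveOn⇒∣p∣≤ {p = twinClass G v} c λ x∈ y∈ →
      c-inj (twinEquiv-trans (twinEquiv-sym (∈-twinClass⁻ x∈)) (∈-twinClass⁻ y∈))

  injectiveOnTwinClasses⇒distinguishing : AlmostAsymmetric G → {k : ℕ} {c : Fin n → Fin k} →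
                                           InjectiveOnTwinClasses c → Distinguishing G c
  injectiveOnTwinClasses⇒distinguishing aa c-inj σ σ-auto σ-preserves-c v =
    ≡.sym (c-inj (aa σ σ-auto v) (≡.sym (σ-preserves-c v)))

  twinRank : Fin n → ℕ
  twinRank v = ∣ below v ∩ twinClass G v ∣

  twinRank-injectiveOnTwinClasses : InjectiveOnTwinClasses twinRank
  twinRank-injectiveOnTwinClasses {u} {v} uv rank≡ =
    ∣below∩p∣-injectiveOn (twinClass G v)
      (∈-twinClass⁺ (twinEquiv-sym uv)) (∈-twinClass⁺ (inj₁ refl))
      (subst (λ C → ∣ below u ∩ C ∣ ≡ twinRank v) (twinClass-cong uv) rank≡)

  twinRankColouring : {s : ℕ} → (∀ v → twinClassSize G v ≤ s) → Fin n → Fin s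
  twinRankColouring s-bound v =
    fromℕ< (<-≤-trans (∣below∩p∣<∣p∣ (∈-twinClass⁺ (inj₁ refl))) (s-bound v))

  twinRankColouring-injectiveOnTwinClasses : {s : ℕ} (s-bound : ∀ v → twinClassSize G v ≤ s) →
                                              InjectiveOnTwinClasses (twinRankColouring s-bound)
  twinRankColouring-injectiveOnTwinClasses s-bound uv colour≡ =
    twinRank-injectiveOnTwinClasses uv
      (trans (≡.sym (toℕ-fromℕ< _)) (trans (cong toℕ colour≡) (toℕ-fromℕ< _)))

  hasDistinguishingColouring⇒twinClassSize≤ : ∀ {k} → HasDistinguishingColouring G k →
                                               ∀ v → twinClassSize G v ≤ k
  hasDistinguishingColouring⇒twinClassSize≤ (_ , c-dist) =
    injectiveOnTwinClasses⇒twinClassSize≤ (distinguishing⇒injectiveOnTwinClasses c-dist)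

  almostAsymmetric⇒hasDistinguishingColouring : AlmostAsymmetric G → ∀ {s} →
                                                 (∀ v → twinClassSize G v ≤ s) →
                                                 HasDistinguishingColouring G s
  almostAsymmetric⇒hasDistinguishingColouring aa s-bound =
    twinRankColouring s-bound ,
    injectiveOnTwinClasses⇒distinguishing aa (twinRankColouring-injectiveOnTwinClasses s-bound)

  almostAsymmetric⇒distinguishingNumber≡maxTwinClassSize :
    AlmostAsymmetric G → ∀ {s d} → IsMaxTwinClassSize G s → IsDistinguishingNumber G d → d ≡ s
  almostAsymmetric⇒distinguishingNumber≡maxTwinClassSize aa ((v , ∣v*∣≡s) , s-max) (D-colouring , d-min) =
    ≤-antisym (d-min _ (almostAsymmetric⇒hasDistinguishingColouring aa s-max))
              (subst (_≤ _) ∣v*∣≡s (hasDistinguishingColouring⇒twinClassSize≤ D-colouring v))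

corollary4p5 : (m : ℕ) → .{{_ : NonZero m}} → {n : ℕ} → (G : Graph n) →
    Connected G → AlmostAsymmetric G →
    (s : ℕ) → IsMaxTwinClassSize G s → s + m ≢ n →
    (d : ℕ) → IsDistinguishingNumber G d → d + m ≢ n
corollary4p5 m G _ aa s s-max s+m≢n d d-D = subst (λ t → t + m ≢ _) (≡.sym d≡s) s+m≢n
  where
  d≡s : d ≡ s
  d≡s = almostAsymmetric⇒distinguishingNumber≡maxTwinClassSize G aa s-max d-D
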